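{- Let $\mathcal{P}\in\mathcal{Q}_n$ be an irreducible combinatorially symmetric sign pattern with a $0$-diagonal, with signed undirected graph $G$ and signed directed graph $D$. Suppose $G$ contains at least one cycle, has no leaf, and the distance between any two path-adjacent cycles in $G$ is odd. Let $\mathcal{C}=u_1u_2\cdots u_k$ ($k\ge3$) be any cycle in $G$. Then $D$ has a composite cycle of length $n$ containing the directed cycle $p_{u_1u_2}p_{u_2u_3}\cdots p_{u_ku_1}$.
   Context: A sign pattern of order $n$ is an $n\times n$ matrix $\mathcal{P}=[p_{ij}]$ with entries in $\{+,-,0\}$; $\mathcal{Q}_n$ is the set of all such patterns. $\mathcal{P}$ has a $0$-diagonal if all $p_{ii}=0$; it is combinatorially symmetric if $p_{ij}\ne0\iff p_{ji}\ne0$. The signed undirected graph $G$ has vertices $1,\dots,n$ and an edge $\{i,j\}$ ($i\ne j$) whenever $p_{ij}\ne0$; irreducibility means $G$ is connected. The signed directed graph $D$ has vertices $1,\dots,n$ and an arc $(i,j)$ whenever $p_{ij}\ne0$. A cycle of $G$ is a simple cycle of length at least $3$; a leaf is a vertex of degree $1$. $\operatorname{dist}(u,v)$ is the length of a shortest path in $G$; the distance between two cycles is the minimum of $\operatorname{dist}(u,w)$ over $u,w$ in the respective cycles. Two cycles $\mathcal{C}_1,\mathcal{C}_2$ are path-adjacent if there is a path $uv_1\cdots v_rw$ in $G$ (for some $r\ge0$) with $u\in V(\mathcal{C}_1)$, $w\in V(\mathcal{C}_2)$ and none of $v_1,\dots,v_r$ a vertex of any cycle of $G$. A simple cycle of $D$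 is a product $p_{i_1i_2}\cdots p_{i_ki_1}$ of nonzero entries with distinct indices; a composite cycle is a product of mutually vertex-disjoint simple cycles, with length the sum of their lengths. -}

module Defs where

open import Data.Nat using (ℕ; _≤_; _%_)
open import Data.Fin using (Fin; _≟_)
open import Data.List using (List; []; _∷_; _++_; length; filter; allFin; concat)
open import Data.List.Membership.Propositional using (_∈_)
open import Data.List.Relation.Unary.All using (All)
open import Data.List.Relation.Unary.Unique.Propositional using (Unique)
open import Data.List.Relation.Unary.Linked using (Linked)
open import Data.Product using (Σ; ∃; ∃-syntax; _×_; _,_)
open import Data.Sum using (_⊎_)
open import Data.Empty using (⊥)
open import Relation.Nullary using (¬_; Dec; yes; no)
open import Relation.Nullary.Decidable using (_×-dec_; ¬?)
open import Relation.Binary.PropositionalEquality using (_≡_; refl)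

data Sign : Set where
  plus minus zer : Sign

SignPattern : ℕ → Set
SignPattern n = Fin n → Fin n → Sign

NZ : Sign → Set
NZ s = ¬ (s ≡ zer)

nz? : (s : Sign) → Dec (NZ s)
nz? plus = yes (λ ())
nz? minus = yes (λ ())
nz? zer = no (λ f → f refl)

module _ {n : ℕ} (P : SignPattern n) where

  ZeroDiagonal : Set
  ZeroDiagonal = ∀ i → P i i ≡ zer

  CombSymmetric : Set
  CombSymmetric = ∀ i j → (NZ (P i j) → NZ (P j i)) × (NZ (P j i) → NZ (P i j))

  Adj : Fin n → Fin n → Set
  Adj i j = ¬ (i ≡ j) × NZ (P i j)

  adj? : (i j : Fin n) → Dec (Adj i j)
  adj? i j = ¬? (i ≟ j) ×-dec nz? (P i j)

  Arc : Fin n → Fin n → Set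
  Arc i j = NZ (P i j)

  degree : Fin n → ℕ
  degree i = length (filter (adj? i) (allFin n))

close : ∀ {A : Set} → List A → List A
close [] = []
close (x ∷ xs) = x ∷ (xs ++ x ∷ [])

lastOf : ∀ {A : Set} → A → List A → A
lastOf x [] = x
lastOf x (y ∷ ys) = lastOf y ys

data Consec {A : Set} (a b : A) : List A → Set where
  here  : ∀ {xs} → Consec a b (a ∷ b ∷ xs)
  there : ∀ {x xs} → Consec a b xs → Consec a b (x ∷ xs)

module _ {n : ℕ} (P : SignPattern n) where

  IsCycle : List (Fin n) → Set
  IsCycle c = (3 ≤ length c) × Unique c × Linked (Adj P) (close c)

  CycEdge : List (Fin n) → Fin n → Fin n → Set
  CycEdge c a b = Consec a b (close c) ⊎ Consec b a (close c)

  -- two cycle sequences describe the same cycle (same edge set)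
  SameCycle : List (Fin n) → List (Fin n) → Set
  SameCycle c₁ c₂ = ∀ a b → (CycEdge c₁ a b → CycEdge c₂ a b) × (CycEdge c₂ a b → CycEdge c₁ a b)

  -- u ∷ xs is a path in G from u to w; its length is length xs
  PathFromTo : Fin n → Fin n → List (Fin n) → Set
  PathFromTo u w xs = Unique (u ∷ xs) × Linked (Adj P) (u ∷ xs) × lastOf u xs ≡ w

  -- irreducible: G connected
  Irreducible : Set
  Irreducible = ∀ u w → ∃[ xs ] PathFromTo u w xs

  HasLeaf : Set
  HasLeaf = ∃[ i ] degree P i ≡ 1

  OnSomeCycle : Fin n → Set
  OnSomeCycle v = ∃[ c ] (IsCycle c × v ∈ c)

  PathAdjacent : List (Fin n) → List (Fin n) → Set
  PathAdjacent c₁ c₂ = ∃[ u ] ∃[ w ] ∃[ vs ]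
    (u ∈ c₁ × w ∈ c₂ × PathFromTo u w (vs ++ w ∷ []) × All (λ v → ¬ OnSomeCycle v) vs)

  CycleDist : List (Fin n) → List (Fin n) → ℕ → Set
  CycleDist c₁ c₂ d =
    (∃[ u ] ∃[ w ] ∃[ xs ] (u ∈ c₁ × w ∈ c₂ × PathFromTo u w xs × length xs ≡ d))
    × (∀ u w xs → u ∈ c₁ → w ∈ c₂ → PathFromTo u w xs → d ≤ length xs)

  IsDiCycle : List (Fin n) → Set
  IsDiCycle c = (1 ≤ length c) × Unique c × Linked (Arc P) (close c)

  IsCompositeCycle : List (List (Fin n)) → Set
  IsCompositeCycle cs = All IsDiCycle cs × Unique (concat cs)

  compLength : List (List (Fin n)) → ℕ
  compLength cs = length (concat cs)

-- Call a vertex off-cycle if it lies on no cycle of G.  Two cycles sharing a vertex but not all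
-- vertices would be path-adjacent at distance 0, so the cycle vertex sets partition the on-cycle
-- vertices.
-- At an off-cycle vertex v, each neighbour a starts an arm: a shortest walk from a to a cycle
-- avoiding v, which exists because G has no leaf.  Two arms at v joined through v form a shortest
-- path between two path-adjacent cycles, so their lengths have odd sum.  Hence exactly one
-- neighbour of v has an arm of odd length; call it the partner of v.  Partnership is a perfect
-- matching of the off-cycle vertices.  The given cycle, one cycle for each other class of cycle
-- vertices and the 2-cycles p_xy p_yx of partners form a composite cycle through every vertex.

module Submission where

open import Defs
open import Data.Nat using (ℕ; zero; suc; _+_; _≤_; _<_; _≤?_; z≤n; s≤s; _%_)
open import Data.Nat.Properties
  using (≤-trans; ≤-refl; ≤-antisym; +-suc; +-comm; m≤n⇒m≤1+n; +-mono-≤; +-monoʳ-≤; +-monoˡ-≤; m≤n+m; m≤m+n; ≮⇒≥; 1+n≰n; anyUpTo?)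
open import Data.Nat.Induction using (<-rec)
open import Data.Bool using (Bool; true; false; not; _xor_)
open import Data.Bool.Properties using (not-involutive; not-distribˡ-xor; true-xor)
open import Data.List using (List; []; _∷_; _++_; [_]; length; concat; allFin; filter)
open import Data.List.Properties using (length-++; length-tabulate)
open import Data.List.Membership.Propositional using (_∈_; _∉_)
open import Data.List.Membership.Propositional.Properties
  using (∈-++⁺ˡ; ∈-++⁺ʳ; ∈-++⁻; ∈-∃++; ∈-allFin; ∈-filter⁺; ∈-filter⁻; ∈-concat⁻′; ∈-concat⁺′)
open import Data.List.Relation.Unary.Any using (here; there)
open import Data.List.Relation.Unary.All as All using (All; []; _∷_)
open import Data.List.Relation.Unary.All.Properties using (¬Any⇒All¬)
open import Data.List.Relation.Unary.Unique.Propositional using (Unique)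
open import Data.List.Relation.Unary.Unique.Propositional.Properties
  using (Unique[x∷xs]⇒x∉xs; allFin⁺; filter⁺) renaming (++⁺ to Unique-++⁺)
open import Data.List.Relation.Unary.AllPairs.Core using ([]; _∷_)
open import Data.List.Relation.Unary.Linked as Linked using (Linked; []; [-]; _∷_)
open import Data.List.Relation.Binary.Subset.Propositional using (_⊆_)
open import Data.Product using (Σ; ∃₂; ∃-syntax; _×_; _,_; proj₁; proj₂)
open import Data.Sum using (_⊎_; inj₁; inj₂)
open import Data.Empty using (⊥-elim)
open import Function using (_∘_; id)
open import Relation.Nullary using (¬_; Dec; yes; no)
open import Relation.Nullary.Decidable using (_×-dec_; ¬?; map′; decidable-stable)
open import Relation.Unary using (Decidable)
open import Data.Fin using (Fin; _≟_)
open import Data.Fin.Properties using (any?)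
open import Relation.Binary.PropositionalEquality
  using (_≡_; _≢_; refl; sym; trans; cong; cong₂; subst; module ≡-Reasoning)

module _ {A : Set} where

  Unique-∷ : ∀ {x : A} {xs} → x ∉ xs → Unique xs → Unique (x ∷ xs)
  Unique-∷ {xs = xs} x∉xs u = ¬Any⇒All¬ xs x∉xs ∷ u

  Unique-∷ʳ⇒∉ : ∀ (xs : List A) {y} → Unique (xs ++ [ y ]) → y ∉ xs
  Unique-∷ʳ⇒∉ (x ∷ xs) u (here refl) = Unique[x∷xs]⇒x∉xs u (∈-++⁺ʳ xs (here refl))
  Unique-∷ʳ⇒∉ (x ∷ xs) (_ ∷ u) (there y∈xs) = Unique-∷ʳ⇒∉ xs u y∈xs

  Unique-⊆⇒length≤ : ∀ {xs ys : List A} → Unique xs → xs ⊆ ys → length xs ≤ length ys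
  Unique-⊆⇒length≤ {[]}     _           _  = z≤n
  Unique-⊆⇒length≤ {x ∷ xs} {ys} u@(_ ∷ uxs) xs⊆ys with ∈-∃++ (xs⊆ys (here refl))
  ... | pre , post , refl = begin
    suc (length xs)                 ≤⟨ s≤s (Unique-⊆⇒length≤ uxs xs⊆pre++post) ⟩
    suc (length (pre ++ post))      ≡⟨ cong suc (length-++ pre) ⟩
    suc (length pre + length post)  ≡⟨ +-suc (length pre) (length post) ⟨
    length pre + length (x ∷ post)  ≡⟨ length-++ pre ⟨
    length (pre ++ x ∷ post)        ∎
    where
    open Data.Nat.Properties.≤-Reasoning
    drop-x : ∀ {e} → e ∈ pre ++ x ∷ post → e ≢ x → e ∈ pre ++ post
    drop-x {e} e∈ e≢x with ∈-++⁻ pre e∈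
    ... | inj₁ e∈pre          = ∈-++⁺ˡ e∈pre
    ... | inj₂ (here e≡x)     = ⊥-elim (e≢x e≡x)
    ... | inj₂ (there e∈post) = ∈-++⁺ʳ pre e∈post
    xs⊆pre++post : xs ⊆ pre ++ post
    xs⊆pre++post e∈xs = drop-x (xs⊆ys (there e∈xs))
      (λ { refl → Unique[x∷xs]⇒x∉xs u e∈xs })

  Linked-++⁻ˡ : ∀ {R : A → A → Set} (xs : List A) {ys} → Linked R (xs ++ ys) → Linked R xs
  Linked-++⁻ˡ []           _       = []
  Linked-++⁻ˡ (x ∷ [])     _       = [-]
  Linked-++⁻ˡ (x ∷ y ∷ xs) (r ∷ l) = r ∷ Linked-++⁻ˡ (y ∷ xs) l

  Linked-∷ʳ : ∀ {R : A → A → Set} {x xs y} →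
              Linked R (x ∷ xs) → R (lastOf x xs) y → Linked R (x ∷ (xs ++ [ y ]))
  Linked-∷ʳ {xs = []}     [-]     r = r ∷ [-]
  Linked-∷ʳ {xs = _ ∷ _} (r₀ ∷ l) r = r₀ ∷ Linked-∷ʳ l r

  Consec-Linked : ∀ {R : A → A → Set} {a b xs} → Consec a b xs → Linked R xs → R a b
  Consec-Linked here      (r ∷ _) = r
  Consec-Linked (there c) l       = Consec-Linked c (Linked.tail l)

  Consec-∈ˡ : ∀ {a b : A} {xs} → Consec a b xs → a ∈ xs
  Consec-∈ˡ here      = here refl
  Consec-∈ˡ (there c) = there (Consec-∈ˡ c)

  Consec-∈ʳ : ∀ {a b : A} {xs} → Consec a b xs → b ∈ xs
  Consec-∈ʳ here      = there (here refl)
  Consec-∈ʳ (there c) = there (Consec-∈ʳ c)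

  ∈-close⁻ : ∀ {x : A} xs → x ∈ close xs → x ∈ xs
  ∈-close⁻ (y ∷ ys) (here x≡y) = here x≡y
  ∈-close⁻ (y ∷ ys) (there x∈) with ∈-++⁻ ys x∈
  ... | inj₁ x∈ys       = there x∈ys
  ... | inj₂ (here x≡y) = here x≡y

  successor-in-close : ∀ {x : A} xs → x ∈ xs → ∃[ y ] Consec x y (close xs)
  successor-in-close (y ∷ ys) = go y ys
    where
    go : ∀ {x} z zs → x ∈ z ∷ zs → ∃[ w ] Consec x w (z ∷ (zs ++ [ y ]))
    go z []       (here refl) = y , here
    go z (z′ ∷ zs) (here refl) = z′ , here
    go z (z′ ∷ zs) (there x∈)  with go z′ zs x∈
    ... | w , c = w , there c

-- Parity and least numbers

isOdd : ℕ → Bool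
isOdd zero    = false
isOdd (suc k) = not (isOdd k)

isOdd-+ : ∀ m k → isOdd (m + k) ≡ isOdd m xor isOdd k
isOdd-+ zero    k = refl
isOdd-+ (suc m) k = trans (cong not (isOdd-+ m k)) (not-distribˡ-xor (isOdd m) (isOdd k))

%2≡1⇒isOdd : ∀ m → m % 2 ≡ 1 → isOdd m ≡ true
%2≡1⇒isOdd (suc zero)    _ = refl
%2≡1⇒isOdd (suc (suc m)) e = trans (not-involutive (isOdd m)) (%2≡1⇒isOdd m e)

1+m+n≤m+[k+n] : ∀ m {k} n → 1 ≤ k → suc m + n ≤ m + (k + n)
1+m+n≤m+[k+n] m {k} n 1≤k = subst (_≤ m + (k + n)) (+-suc m n) (+-monoʳ-≤ m (+-monoˡ-≤ n 1≤k))

Least : (ℕ → Set) → ℕ → Set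
Least Q m = Q m × (∀ {j} → j < m → ¬ Q j)

least : ∀ {Q : ℕ → Set} → Decidable Q → ∀ {k} → Q k → ∃[ m ] Least Q m
least {Q} Q? {k} = <-rec (λ k → Q k → ∃[ m ] Least Q m) go k
  where
  go : ∀ k → (∀ {j} → j < k → Q j → ∃[ m ] Least Q m) → Q k → ∃[ m ] Least Q m
  go k rec qk with anyUpTo? Q? k
  ... | yes (j , j<k , qj) = rec j<k qj
  ... | no none            = k , qk , λ j<k qj → none (_ , j<k , qj)

-- Walks in a graph

module Walks {V : Set} (E : V → V → Set) where

  infixr 5 _∷w_ _++w_

  data Walk : V → V → Set where
    wnil : ∀ {x} → Walk x x
    _∷w_ : ∀ {x y z} → E x y → Walk y z → Walk x z

  vtail : ∀ {x z} → Walk x z → List V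
  vtail wnil                 = []
  vtail (_∷w_ {y = y} _ w) = y ∷ vtail w

  verts : ∀ {x z} → Walk x z → List V
  verts {x} w = x ∷ vtail w

  len : ∀ {x z} → Walk x z → ℕ
  len wnil     = 0
  len (_ ∷w w) = suc (len w)

  _++w_ : ∀ {x y z} → Walk x y → Walk y z → Walk x z
  wnil     ++w w′ = w′
  (e ∷w w) ++w w′ = e ∷w (w ++w w′)

  len-++ : ∀ {x y z} (w : Walk x y) (w′ : Walk y z) → len (w ++w w′) ≡ len w + len w′
  len-++ wnil     w′ = refl
  len-++ (e ∷w w) w′ = cong suc (len-++ w w′)

  length-vtail : ∀ {x z} (w : Walk x z) → length (vtail w) ≡ len w
  length-vtail wnil     = refl
  length-vtail (e ∷w w) = cong suc (length-vtail w)

  ∈-verts-++⁻ : ∀ {x y z e} (w : Walk x y) (w′ : Walk y z) →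
                e ∈ verts (w ++w w′) → e ∈ verts w ⊎ e ∈ verts w′
  ∈-verts-++⁻ wnil     w′ e∈           = inj₂ e∈
  ∈-verts-++⁻ (f ∷w w) w′ (here e≡x)   = inj₁ (here e≡x)
  ∈-verts-++⁻ (f ∷w w) w′ (there e∈) with ∈-verts-++⁻ w w′ e∈
  ... | inj₁ e∈w  = inj₁ (there e∈w)
  ... | inj₂ e∈w′ = inj₂ e∈w′

  ∉-verts-++ : ∀ {x y z v} (w : Walk x y) (w′ : Walk y z) →
               v ∉ verts w → v ∉ verts w′ → v ∉ verts (w ++w w′)
  ∉-verts-++ w w′ v∉w v∉w′ v∈ with ∈-verts-++⁻ w w′ v∈
  ... | inj₁ v∈w  = v∉w v∈w
  ... | inj₂ v∈w′ = v∉w′ v∈w′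

  verts-++ : ∀ {x y z} (w : Walk x y) (w′ : Walk y z) → verts (w ++w w′) ≡ verts w ++ vtail w′
  verts-++ wnil     w′ = refl
  verts-++ {x} (e ∷w w) w′ = cong (x ∷_) (verts-++ w w′)

  length-verts : ∀ {x z} (w : Walk x z) → length (verts w) ≡ suc (len w)
  length-verts w = cong suc (length-vtail w)

  vtail-∷ʳ : ∀ {x z} (w : Walk x z) → 0 < len w → ∃[ vs ] vtail w ≡ vs ++ [ z ]
  vtail-∷ʳ (e ∷w wnil)                   _ = [] , refl
  vtail-∷ʳ (_∷w_ {y = y} e w@(_ ∷w _)) _ with vtail-∷ʳ w (s≤s z≤n)
  ... | vs , eq = y ∷ vs , cong (y ∷_) eq

  Walk⇒Linked : ∀ {x z} (w : Walk x z) → Linked E (verts w)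
  Walk⇒Linked wnil     = [-]
  Walk⇒Linked (e ∷w w) = e ∷ Walk⇒Linked w

  lastOf-vtail : ∀ {x z} (w : Walk x z) → lastOf x (vtail w) ≡ z
  lastOf-vtail wnil     = refl
  lastOf-vtail (e ∷w w) = lastOf-vtail w

  Linked⇒Walk : ∀ {x z} xs → Linked E (x ∷ xs) → lastOf x xs ≡ z → Σ (Walk x z) λ w → vtail w ≡ xs
  Linked⇒Walk []       [-]     refl = wnil , refl
  Linked⇒Walk (y ∷ xs) (e ∷ l) last with Linked⇒Walk xs l last
  ... | w , refl = e ∷w w , refl

  walk-along : ∀ {x} xs → Linked E (x ∷ xs) → ∀ {e} → e ∈ x ∷ xs → Σ (Walk x e) λ w → verts w ⊆ x ∷ xs
  walk-along xs       l        (here refl) = wnil , λ { (here refl) → here refl }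
  walk-along (y ∷ xs) (xy ∷ l) (there e∈) with walk-along xs l e∈
  ... | w , w⊆ = xy ∷w w , λ { (here refl) → here refl ; (there e′∈) → there (w⊆ e′∈) }

  prefix : ∀ {x z e} (w : Walk x z) → e ∈ verts w →
           Σ (Walk x e) λ p → verts p ⊆ verts w × (e ≢ z → len p < len w)
  prefix wnil     (here refl) = wnil , id , λ e≢z → ⊥-elim (e≢z refl)
  prefix (f ∷w w) (here refl) = wnil , (λ { (here refl) → here refl }) , λ _ → s≤s z≤n
  prefix (f ∷w w) (there e∈) with prefix w e∈
  ... | p , p⊆w , shorter =
    f ∷w p , (λ { (here refl) → here refl ; (there e′∈) → there (p⊆w e′∈) }) , s≤s ∘ shorter

  suffix : ∀ {x z e} (w : Walk x z) → e ∈ verts w →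
           Σ (Walk e z) λ s → len s ≤ len w × verts s ⊆ verts w × (Unique (verts w) → Unique (verts s))
  suffix w        (here refl) = w , ≤-refl , id , id
  suffix (f ∷w w) (there e∈) with suffix w e∈
  ... | s , s≤w , s⊆w , uniq = s , m≤n⇒m≤1+n s≤w , there ∘ s⊆w , λ { (_ ∷ u) → uniq u }

  module Reversal (E-sym : ∀ {x y} → E x y → E y x) where

    reverse : ∀ {x z} → Walk x z → Walk z x
    reverse wnil     = wnil
    reverse (e ∷w w) = reverse w ++w (E-sym e ∷w wnil)

    len-reverse : ∀ {x z} (w : Walk x z) → len (reverse w) ≡ len w
    len-reverse wnil     = refl
    len-reverse (e ∷w w) = trans (len-++ (reverse w) _) (trans (+-comm (len (reverse w)) 1) (cong suc (len-reverse w)))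

    ∈-verts-reverse⁻ : ∀ {x z e} (w : Walk x z) → e ∈ verts (reverse w) → e ∈ verts w
    ∈-verts-reverse⁻ wnil     e∈ = e∈
    ∈-verts-reverse⁻ (f ∷w w) e∈ with ∈-verts-++⁻ (reverse w) (E-sym f ∷w wnil) e∈
    ... | inj₁ e∈w                 = there (∈-verts-reverse⁻ w e∈w)
    ... | inj₂ (here e≡y)          = there (here e≡y)
    ... | inj₂ (there (here e≡x))  = here e≡x

    ∉-verts-reverse : ∀ {x z v} (w : Walk x z) → v ∉ verts w → v ∉ verts (reverse w)
    ∉-verts-reverse w v∉w = v∉w ∘ ∈-verts-reverse⁻ w

  module Visits (_≟V_ : (x y : V) → Dec (x ≡ y)) where
    open import Data.List.Membership.DecPropositional _≟V_ using (_∈?_)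

    record FirstVisit {x z} (v : V) (w : Walk x z) : Set where
      constructor firstVisit
      field
        {pred}   : V
        entry    : E pred v
        before   : Walk x pred
        v∉before : v ∉ verts before
        after    : Walk v z
        len-eq   : len before + suc (len after) ≡ len w

    first-visit : ∀ {x z v} (w : Walk x z) → v ∈ verts w → v ≢ x → FirstVisit v w
    first-visit wnil     (here v≡x) v≢x = ⊥-elim (v≢x v≡x)
    first-visit (f ∷w w) (here v≡x) v≢x = ⊥-elim (v≢x v≡x)
    first-visit {v = v} (_∷w_ {y = y} f w) (there v∈) v≢x with v ≟V y
    ... | yes refl = firstVisit f wnil (λ { (here v≡x) → v≢x v≡x }) w refl
    ... | no v≢y with first-visit w v∈ v≢y
    ...   | firstVisit e w₁ v∉w₁ w₂ eq =
      firstVisit e (f ∷w w₁) (λ { (here v≡x) → v≢x v≡x ; (there v∈w₁) → v∉w₁ v∈w₁ }) w₂ (cong suc eq)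

    record LastVisit {x z} (v : V) (w : Walk x z) : Set where
      constructor lastVisit
      field
        {succ}  : V
        exit    : E v succ
        after   : Walk succ z
        v∉after : v ∉ verts after
        shorter : len after < len w
        after⊆w : verts after ⊆ verts w

    last-visit : ∀ {x z v} (w : Walk x z) → v ∈ verts w → v ≢ z → LastVisit v w
    last-visit wnil (here v≡z) v≢z = ⊥-elim (v≢z v≡z)
    last-visit {v = v} (_∷w_ {y = y} f w) v∈ v≢z with v ∈? verts w | v∈
    ... | yes v∈w | _ with last-visit w v∈w v≢z
    ...   | lastVisit e w′ v∉w′ l w′⊆w = lastVisit e w′ v∉w′ (m≤n⇒m≤1+n l) (there ∘ w′⊆w)
    last-visit (f ∷w w) v∈ v≢z | no v∉w | here refl   = lastVisit f w v∉w ≤-refl there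
    last-visit (f ∷w w) v∈ v≢z | no v∉w | there v∈w   = ⊥-elim (v∉w v∈w)

    shortcut : ∀ {x z} (w : Walk x z) →
               Σ (Walk x z) λ p → Unique (verts p) × len p ≤ len w × verts p ⊆ verts w
    shortcut wnil = wnil , [] ∷ [] , z≤n , id
    shortcut {x} (f ∷w w) with shortcut w
    ... | p , u , p≤w , p⊆w with x ∈? verts p
    ...   | no x∉p  = f ∷w p , Unique-∷ x∉p u , s≤s p≤w , λ { (here refl) → here refl ; (there e∈) → there (p⊆w e∈) }
    ...   | yes x∈p with suffix p x∈p
    ...     | s , s≤p , s⊆p , uniq = s , uniq u , m≤n⇒m≤1+n (≤-trans s≤p p≤w) , there ∘ p⊆w ∘ s⊆p

-- The graph of a combinatorially symmetric sign pattern

module _ {n : ℕ} where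
  open import Data.Nat.Properties using (suc-injective)

  ∃-ofLength? : {Q : List (Fin n) → Set} → Decidable Q → ∀ k → Dec (∃[ xs ] (length xs ≡ k × Q xs))
  ∃-ofLength? Q? zero = map′ (λ q → [] , refl , q) (λ { ([] , _ , q) → q }) (Q? [])
  ∃-ofLength? Q? (suc k) =
    map′ (λ { (x , xs , l , q) → x ∷ xs , cong suc l , q })
         (λ { (x ∷ xs , l , q) → x , xs , suc-injective l , q })
         (any? λ x → ∃-ofLength? (λ xs → Q? (x ∷ xs)) k)

  Unique⇒length≤n : {xs : List (Fin n)} → Unique xs → length xs ≤ n
  Unique⇒length≤n {xs} u =
    subst (length xs ≤_) (length-tabulate id) (Unique-⊆⇒length≤ u λ {x} _ → ∈-allFin x)

module SignGraph {n : ℕ} (P : SignPattern n) (csym : CombSymmetric P) where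
  open import Data.List.Membership.DecPropositional (_≟_ {n}) using (_∈?_)
  open import Data.List.Relation.Unary.Unique.DecPropositional (_≟_ {n}) using (unique?)

  Adj-sym : ∀ {i j} → Adj P i j → Adj P j i
  Adj-sym {i} {j} (i≢j , nz) = (i≢j ∘ sym) , proj₁ (csym i j) nz

  Adj-irrefl : ∀ {i j} → Adj P i j → i ≢ j
  Adj-irrefl = proj₁

  open Walks (Adj P) public
  open Reversal Adj-sym public
  open Visits _≟_ public

  Walk⇒Path : ∀ {x z} (w : Walk x z) → Unique (verts w) → PathFromTo P x z (vtail w)
  Walk⇒Path w u = u , Walk⇒Linked w , lastOf-vtail w

  Path⇒Walk : ∀ {x z xs} → PathFromTo P x z xs → Σ (Walk x z) λ w → len w ≡ length xs
  Path⇒Walk {xs = xs} (_ , l , last) with Linked⇒Walk xs l last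
  ... | w , refl = w , sym (length-vtail w)

  OnCycle : Fin n → Set
  OnCycle = OnSomeCycle P

  IsCycle? : Decidable (IsCycle P)
  IsCycle? c = (3 ≤? length c) ×-dec (unique? c ×-dec Linked.linked? (adj? P) (close c))

  OnCycle? : Decidable OnCycle
  OnCycle? v = map′
    (λ { (_ , _ , c , _ , isC , v∈c) → c , isC , v∈c })
    (λ { (c , isC@(_ , u , _) , v∈c) → length c , s≤s (Unique⇒length≤n u) , c , refl , isC , v∈c })
    (anyUpTo? (∃-ofLength? λ c → IsCycle? c ×-dec (v ∈? c)) (suc n))

  cycle-walk : ∀ {c x y} → IsCycle P c → x ∈ c → y ∈ c → Σ (Walk x y) λ w → verts w ⊆ c
  cycle-walk {h ∷ t} (_ , _ , l) x∈c y∈c with walk-along t (Linked-++⁻ˡ (h ∷ t) l) x∈c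
                                            | walk-along t (Linked-++⁻ˡ (h ∷ t) l) y∈c
  ... | wx , wx⊆c | wy , wy⊆c = reverse wx ++w wy , λ e∈ → on-c (∈-verts-++⁻ (reverse wx) wy e∈)
    where
    on-c : ∀ {e} → e ∈ verts (reverse wx) ⊎ e ∈ verts wy → e ∈ h ∷ t
    on-c (inj₁ e∈) = wx⊆c (∈-verts-reverse⁻ wx e∈)
    on-c (inj₂ e∈) = wy⊆c e∈

  cycle-neighbour : ∀ {c x} → IsCycle P c → x ∈ c → ∃[ y ] (Adj P x y × y ∈ c)
  cycle-neighbour {c} (_ , _ , l) x∈c with successor-in-close c x∈c
  ... | y , xy = y , Consec-Linked xy l , ∈-close⁻ c (Consec-∈ʳ xy)

  SameCycle⇒⊇ : ∀ {c₁ c₂} → SameCycle P c₁ c₂ → c₂ ⊆ c₁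
  SameCycle⇒⊇ {c₁} {c₂} same {x} x∈c₂ with successor-in-close c₂ x∈c₂
  ... | y , xy with proj₂ (same x y) (inj₁ xy)
  ...   | inj₁ xy₁ = ∈-close⁻ c₁ (Consec-∈ˡ xy₁)
  ...   | inj₂ yx₁ = ∈-close⁻ c₁ (Consec-∈ʳ yx₁)

  WalkAvoiding : Fin n → Fin n → Fin n → Set
  WalkAvoiding v x y = Σ (Walk x y) λ w → v ∉ verts w

  infixr 5 _++ᵃ_

  _++ᵃ_ : ∀ {v x y z} → WalkAvoiding v x y → WalkAvoiding v y z → WalkAvoiding v x z
  (w , v∉w) ++ᵃ (w′ , v∉w′) = w ++w w′ , ∉-verts-++ w w′ v∉w v∉w′

  reverseᵃ : ∀ {v x y} → WalkAvoiding v x y → WalkAvoiding v y x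
  reverseᵃ (w , v∉w) = reverse w , ∉-verts-reverse w v∉w

  offCycle-separates : ∀ {v a b} → ¬ OnCycle v → Adj P v a → Adj P v b → a ≢ b → ¬ WalkAvoiding v a b
  offCycle-separates {v} {a} {b} v∉cyc va vb a≢b (w , v∉w) with shortcut w
  ... | wnil , _ = a≢b refl
  ... | p@(_ ∷w _) , u , _ , p⊆w = v∉cyc (v ∷ verts p , isCycle , here refl)
    where
    isCycle : IsCycle P (v ∷ verts p)
    isCycle = s≤s (s≤s (s≤s z≤n)) , Unique-∷ (v∉w ∘ p⊆w) u ,
              va ∷ Linked-∷ʳ (Walk⇒Linked p) (subst (λ t → Adj P t v) (sym (lastOf-vtail p)) (Adj-sym vb))

module OddCycleDistances {n : ℕ} (P : SignPattern n)
  (irreducible : Irreducible P) (csym : CombSymmetric P) (some-cycle : ∃[ c ] IsCycle P c)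
  (no-leaf : ¬ HasLeaf P)
  (odd-distance : ∀ c₁ c₂ → IsCycle P c₁ → IsCycle P c₂ → ¬ SameCycle P c₁ c₂ →
                  PathAdjacent P c₁ c₂ → ∀ d → CycleDist P c₁ c₂ d → d % 2 ≡ 1) where
  open SignGraph P csym
  open import Data.List.Membership.DecPropositional (_≟_ {n}) using (_∈?_)

  private
    V : Set
    V = Fin n
    E : V → V → Set
    E = Adj P

  -- Cycles sharing a vertex are path-adjacent at distance 0.
  meeting-cycles-⊆ : ∀ {c₁ c₂ y} → IsCycle P c₁ → IsCycle P c₂ → y ∈ c₁ → y ∈ c₂ → c₂ ⊆ c₁
  meeting-cycles-⊆ {c₁} {c₂} {y} c₁-cycle c₂-cycle y∈c₁ y∈c₂ {x} x∈c₂ with x ∈? c₁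
  ... | yes x∈c₁ = x∈c₁
  ... | no x∉c₁ with cycle-neighbour c₂-cycle y∈c₂
  ...   | w , yw , w∈c₂ with odd-distance c₁ c₂ c₁-cycle c₂-cycle (λ same → x∉c₁ (SameCycle⇒⊇ same x∈c₂))
                             adjacent 0 distance-0
    where
    adjacent : PathAdjacent P c₁ c₂
    adjacent = y , w , [] , y∈c₁ , w∈c₂ ,
               (Unique-∷ (λ { (here refl) → Adj-irrefl yw refl }) ([] ∷ []) , yw ∷ [-] , refl) , []
    distance-0 : CycleDist P c₁ c₂ 0
    distance-0 = (y , y , [] , y∈c₁ , y∈c₂ , ([] ∷ [] , [-] , refl) , refl) , λ _ _ _ _ _ _ → z≤n
  ... | ()

  neighbour-exists : ∀ y → ∃[ a ] E y a
  neighbour-exists y with other-vertex some-cycle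
    where
    other-vertex : ∃[ c ] IsCycle P c → ∃[ w ] y ≢ w
    other-vertex (c₁ ∷ c₂ ∷ _ , _ , u , _) with y ≟ c₁
    ... | yes refl = c₂ , λ { refl → Unique[x∷xs]⇒x∉xs u (here refl) }
    ... | no y≢c₁  = c₁ , y≢c₁
    other-vertex (_ ∷ [] , s≤s () , _)
  ... | w , y≢w with irreducible y w
  ...   | [] , _ , _ , y≡w           = ⊥-elim (y≢w y≡w)
  ...   | a ∷ _ , _ , ya ∷ _ , _     = a , ya

  two-neighbours : ∀ y → ∃₂ λ a b → E y a × E y b × a ≢ b
  two-neighbours y = from-list (filter (adj? P y) (allFin n)) refl
    where
    neighbour : ∀ {a} → a ∈ filter (adj? P y) (allFin n) → E y a
    neighbour a∈ = proj₂ (∈-filter⁻ (adj? P y) {xs = allFin n} a∈)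
    from-list : ∀ L → filter (adj? P y) (allFin n) ≡ L → ∃₂ λ a b → E y a × E y b × a ≢ b
    from-list []          eq with neighbour-exists y
    ... | a , ya with subst (a ∈_) eq (∈-filter⁺ (adj? P y) (∈-allFin a) ya)
    ...   | ()
    from-list (a ∷ [])     eq = ⊥-elim (no-leaf (y , cong length eq))
    from-list (a ∷ b ∷ _) eq =
      a , b , neighbour (subst (a ∈_) (sym eq) (here refl)) , neighbour (subst (b ∈_) (sym eq) (there (here refl))) ,
      λ { refl → Unique[x∷xs]⇒x∉xs (subst Unique eq (filter⁺ (adj? P y) (allFin⁺ n))) (here refl) }

  -- Of two neighbours of y, one is not the next vertex of R, and it cannot lie on R:
  -- that would close a cycle through y.
  fresh-neighbour : ∀ {y z} → ¬ OnCycle y → (R : Walk y z) → Unique (verts R) → 0 < len R →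
                    ∃[ y′ ] (E y y′ × y′ ∉ verts R)
  fresh-neighbour {y} y∉cyc R@(_∷w_ {y = p} e R₁) u _ with two-neighbours y
  ... | n₁ , n₂ , yn₁ , yn₂ , n₁≢n₂ = choose (n₁ ≟ p)
    where
    fresh : ∀ {y′} → E y y′ → y′ ≢ p → ∃[ y′ ] (E y y′ × y′ ∉ verts R)
    fresh {y′} yy′ y′≢p with y′ ∈? verts R
    ... | no y′∉R              = y′ , yy′ , y′∉R
    ... | yes (here refl)      = ⊥-elim (Adj-irrefl yy′ refl)
    ... | yes (there y′∈R₁) with prefix R₁ y′∈R₁
    ...   | w , w⊆R₁ , _ = ⊥-elim (offCycle-separates y∉cyc e yy′ (y′≢p ∘ sym) (w , Unique[x∷xs]⇒x∉xs u ∘ w⊆R₁))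
    choose : Dec (n₁ ≡ p) → ∃[ y′ ] (E y y′ × y′ ∉ verts R)
    choose (yes refl) = fresh yn₂ (n₁≢n₂ ∘ sym)
    choose (no n₁≢p)  = fresh yn₁ n₁≢p

  record Arm (v a : V) (k : ℕ) : Set where
    constructor arm
    field
      {end}        : V
      end-on-cycle : OnCycle end
      walk         : Walk a end
      len-walk     : len walk ≡ k
      v∉walk       : v ∉ verts walk

  Arm? : ∀ v a k → Dec (Arm v a k)
  Arm? v a k = map′ from-list to-list (∃-ofLength? Q? k)
    where
    Q : List V → Set
    Q xs = Linked E (a ∷ xs) × v ∉ a ∷ xs × OnCycle (lastOf a xs)
    Q? : Decidable Q
    Q? xs = Linked.linked? (adj? P) (a ∷ xs) ×-dec (¬? (v ∈? (a ∷ xs)) ×-dec OnCycle? (lastOf a xs))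
    from-list : ∃[ xs ] (length xs ≡ k × Q xs) → Arm v a k
    from-list (xs , len-xs , l , v∉ , cyc) with Linked⇒Walk xs l refl
    ... | w , vtail≡xs =
      arm cyc w (trans (sym (length-vtail w)) (trans (cong length vtail≡xs) len-xs))
          (v∉ ∘ subst (λ t → v ∈ a ∷ t) vtail≡xs)
    to-list : Arm v a k → ∃[ xs ] (length xs ≡ k × Q xs)
    to-list (arm cyc w refl v∉w) =
      vtail w , length-vtail w , Walk⇒Linked w , v∉w , subst OnCycle (sym (lastOf-vtail w)) cyc

  module _ {v a} (v∉cyc : ¬ OnCycle v) (va : E v a) where
    private
      back : Walk a v
      back = Adj-sym va ∷w wnil

    -- Grow a path y ⋯ a v backwards until it reaches a cycle; the fuel bounds its length.
    arm-from : ∀ fuel {y} (r : Walk y a) → Unique (verts (r ++w back)) → n ≤ fuel + len r → ∃[ k ] Arm v a k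
    arm-from fuel {y} r u bound with OnCycle? y
    ... | yes y-cyc = len (reverse r) , arm y-cyc (reverse r) refl (∉-verts-reverse r v∉r)
      where
      v∉r : v ∉ verts r
      v∉r = Unique-∷ʳ⇒∉ (verts r) (subst Unique (verts-++ r back) u)
    arm-from zero r u bound | no _ = ⊥-elim (1+n≰n (begin
      suc (len r)                 ≤⟨ s≤s (m≤m+n (len r) 1) ⟩
      suc (len r + 1)             ≡⟨ cong suc (len-++ r back) ⟨
      suc (len (r ++w back))      ≡⟨ length-verts (r ++w back) ⟨
      length (verts (r ++w back)) ≤⟨ Unique⇒length≤n u ⟩
      n                           ≤⟨ bound ⟩
      len r                       ∎))
      where open Data.Nat.Properties.≤-Reasoning
    arm-from (suc fuel) r u bound | no y∉cyc
      with fresh-neighbour y∉cyc (r ++w back) u (subst (0 <_) (sym (len-++ r back)) (m≤n+m 1 (len r)))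
    ... | y′ , yy′ , y′∉ =
      arm-from fuel (Adj-sym yy′ ∷w r) (Unique-∷ y′∉ u) (subst (n ≤_) (sym (+-suc fuel (len r))) bound)

    arm-exists : ∃[ k ] Arm v a k
    arm-exists = arm-from n wnil (Unique-∷ (λ { (here refl) → Adj-irrefl va refl }) ([] ∷ [])) (m≤m+n n 0)

  MinimalArm : V → V → ℕ → Set
  MinimalArm v a = Least (Arm v a)

  minimal-arm : ∀ {v a} → ¬ OnCycle v → E v a → ∃[ k ] MinimalArm v a k
  minimal-arm {v} {a} v∉cyc va = least (Arm? v a) (proj₂ (arm-exists v∉cyc va))

  MinimalArm⇒≤ : ∀ {v a k j} → MinimalArm v a k → Arm v a j → k ≤ j
  MinimalArm⇒≤ (_ , minimal) α = ≮⇒≥ λ j<k → minimal j<k α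

  MinimalArm-interior : ∀ {v a k e} ((α , _) : MinimalArm v a k) →
                        e ∈ verts (Arm.walk α) → OnCycle e → e ≡ Arm.end α
  MinimalArm-interior {e = e} (arm {z} _ w refl v∉w , minimal) e∈w e-cyc with e ≟ z
  ... | yes e≡z = e≡z
  ... | no e≢z with prefix w e∈w
  ...   | w′ , w′⊆w , shorter = ⊥-elim (minimal (shorter e≢z) (arm e-cyc w′ refl (v∉w ∘ w′⊆w)))

  module TwoArms {v a b ka kb} (v∉cyc : ¬ OnCycle v) (va : E v a) (vb : E v b) (a≢b : a ≢ b)
                 (μa : MinimalArm v a ka) (μb : MinimalArm v b kb) where
    open Arm (proj₁ μa) renaming (end to za; end-on-cycle to za-cyc; walk to wa; len-walk to len-wa; v∉walk to v∉wa)
    open Arm (proj₁ μb) renaming (end to zb; end-on-cycle to zb-cyc; walk to wb; len-walk to len-wb; v∉walk to v∉wb)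

    ca cb : List V
    ca = proj₁ za-cyc
    cb = proj₁ zb-cyc

    ca-cycle : IsCycle P ca
    ca-cycle = proj₁ (proj₂ za-cyc)
    cb-cycle : IsCycle P cb
    cb-cycle = proj₁ (proj₂ zb-cyc)

    za∈ca : za ∈ ca
    za∈ca = proj₂ (proj₂ za-cyc)
    zb∈cb : zb ∈ cb
    zb∈cb = proj₂ (proj₂ zb-cyc)

    αa : WalkAvoiding v a za
    αa = wa , v∉wa
    αb : WalkAvoiding v b zb
    αb = wb , v∉wb

    separates : ∀ {x y} → E v x → E v y → x ≢ y → ¬ WalkAvoiding v x y
    separates = offCycle-separates v∉cyc

    around : ∀ {c x y} → IsCycle P c → x ∈ c → y ∈ c → WalkAvoiding v x y
    around c-cycle x∈c y∈c with cycle-walk c-cycle x∈c y∈c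
    ... | w , w⊆c = w , λ v∈w → v∉cyc (_ , c-cycle , w⊆c v∈w)

    zb∉ca : zb ∉ ca
    zb∉ca zb∈ca = separates va vb a≢b (αa ++ᵃ around ca-cycle za∈ca zb∈ca ++ᵃ reverseᵃ αb)

    distinct : ¬ SameCycle P ca cb
    distinct same = zb∉ca (SameCycle⇒⊇ same zb∈cb)

    d : ℕ
    d = 2 + (ka + kb)

    d≡ka+2+kb : d ≡ ka + (2 + kb)
    d≡ka+2+kb = sym (trans (+-suc ka (suc kb)) (cong suc (+-suc ka kb)))

    -- A walk from ca to cb must cross v, entering from a and leaving towards b.
    long : ∀ {p q} (w : Walk p q) → p ∈ ca → q ∈ cb → d ≤ len w
    long {p} {q} w p∈ca q∈cb with v ∈? verts w
    ... | no v∉w = ⊥-elim (separates va vb a≢b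
                    (αa ++ᵃ around ca-cycle za∈ca p∈ca ++ᵃ (w , v∉w) ++ᵃ around cb-cycle q∈cb zb∈cb ++ᵃ reverseᵃ αb))
    ... | yes v∈w with first-visit w v∈w (λ { refl → v∉cyc (ca , ca-cycle , p∈ca) })
    ...   | firstVisit {u} uv w₁ v∉w₁ w₂ len-w
      with last-visit w₂ (here refl) (λ { refl → v∉cyc (cb , cb-cycle , q∈cb) })
    ...   | lastVisit {y} vy w₂′ v∉w₂′ w₂′<w₂ _ = enter-leave (u ≟ a) (y ≟ b)
      where
      enter-leave : Dec (u ≡ a) → Dec (y ≡ b) → d ≤ len w
      enter-leave (no u≢a) _ =
        ⊥-elim (separates (Adj-sym uv) va u≢a (reverseᵃ (w₁ , v∉w₁) ++ᵃ around ca-cycle p∈ca za∈ca ++ᵃ reverseᵃ αa))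
      enter-leave _ (no y≢b) =
        ⊥-elim (separates vy vb y≢b ((w₂′ , v∉w₂′) ++ᵃ around cb-cycle q∈cb zb∈cb ++ᵃ reverseᵃ αb))
      enter-leave (yes refl) (yes refl) = begin
        d                       ≡⟨ d≡ka+2+kb ⟩
        ka + (2 + kb)           ≤⟨ +-mono-≤ ka≤w₁ (s≤s (≤-trans (s≤s kb≤w₂′) w₂′<w₂)) ⟩
        len w₁ + suc (len w₂)   ≡⟨ len-w ⟩
        len w                   ∎
        where
        open Data.Nat.Properties.≤-Reasoning
        ka≤w₁ : ka ≤ len w₁
        ka≤w₁ = MinimalArm⇒≤ μa (arm (ca , ca-cycle , p∈ca) (reverse w₁) (len-reverse w₁) (∉-verts-reverse w₁ v∉w₁))
        kb≤w₂′ : kb ≤ len w₂′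
        kb≤w₂′ = MinimalArm⇒≤ μb (arm (cb , cb-cycle , q∈cb) w₂′ refl v∉w₂′)

    bridge : Walk za zb
    bridge = reverse wa ++w (Adj-sym va ∷w vb ∷w wb)

    len-bridge : len bridge ≡ d
    len-bridge = begin
      len bridge                        ≡⟨ len-++ (reverse wa) _ ⟩
      len (reverse wa) + (2 + len wb)   ≡⟨ cong₂ (λ i j → i + (2 + j)) (trans (len-reverse wa) len-wa) len-wb ⟩
      ka + (2 + kb)                     ≡⟨ d≡ka+2+kb ⟨
      d                                 ∎
      where open ≡-Reasoning

    bridge-cycle-vertices : ∀ {e} → e ∈ verts bridge → OnCycle e → e ≡ za ⊎ e ≡ zb
    bridge-cycle-vertices e∈ e-cyc with ∈-verts-++⁻ (reverse wa) (Adj-sym va ∷w vb ∷w wb) e∈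
    ... | inj₁ e∈wa                = inj₁ (MinimalArm-interior μa (∈-verts-reverse⁻ wa e∈wa) e-cyc)
    ... | inj₂ (here refl)         = inj₁ (MinimalArm-interior μa (here refl) e-cyc)
    ... | inj₂ (there (here refl)) = ⊥-elim (v∉cyc e-cyc)
    ... | inj₂ (there (there e∈wb)) = inj₂ (MinimalArm-interior μb e∈wb e-cyc)

    path : Walk za zb
    path = proj₁ (shortcut bridge)

    path-unique : Unique (verts path)
    path-unique = proj₁ (proj₂ (shortcut bridge))

    path≤bridge : len path ≤ len bridge
    path≤bridge = proj₁ (proj₂ (proj₂ (shortcut bridge)))

    path⊆bridge : verts path ⊆ verts bridge
    path⊆bridge = proj₂ (proj₂ (proj₂ (shortcut bridge)))

    len-path : len path ≡ d
    len-path = ≤-antisym (subst (len path ≤_) len-bridge path≤bridge) (long path za∈ca zb∈cb)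

    distance : CycleDist P ca cb d
    distance = (za , zb , vtail path , za∈ca , zb∈cb , Walk⇒Path path path-unique , trans (length-vtail path) len-path)
             , λ p q ys p∈ca q∈cb p→q → let w , len-w = Path⇒Walk p→q in subst (d ≤_) len-w (long w p∈ca q∈cb)

    adjacent : PathAdjacent P ca cb
    adjacent with vtail-∷ʳ path (subst (0 <_) (sym len-path) (s≤s z≤n))
    ... | vs , vtail≡ = za , zb , vs , za∈ca , zb∈cb , subst (PathFromTo P za zb) vtail≡ (Walk⇒Path path path-unique) ,
                        All.tabulate interior-offCycle
      where
      vs⊆vtail : ∀ {e} → e ∈ vs → e ∈ vtail path
      vs⊆vtail {e} e∈vs = subst (e ∈_) (sym vtail≡) (∈-++⁺ˡ e∈vs)
      interior-offCycle : ∀ {e} → e ∈ vs → ¬ OnCycle e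
      interior-offCycle e∈vs e-cyc with bridge-cycle-vertices (path⊆bridge (there (vs⊆vtail e∈vs))) e-cyc | path-unique
      ... | inj₁ refl | _          = Unique[x∷xs]⇒x∉xs path-unique (vs⊆vtail e∈vs)
      ... | inj₂ refl | _ ∷ unique = Unique-∷ʳ⇒∉ vs (subst Unique vtail≡ unique) e∈vs

    odd-sum : isOdd (ka + kb) ≡ true
    odd-sum = trans (sym (not-involutive (isOdd (ka + kb))))
                    (%2≡1⇒isOdd d (odd-distance ca cb ca-cycle cb-cycle distinct adjacent d distance))

  odd-arm-sum : ∀ {v a b ka kb} → ¬ OnCycle v → E v a → E v b → a ≢ b →
                MinimalArm v a ka → MinimalArm v b kb → isOdd (ka + kb) ≡ true
  odd-arm-sum v∉cyc va vb a≢b μa μb = TwoArms.odd-sum v∉cyc va vb a≢b μa μb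

  Partner : V → V → Set
  Partner x y = E x y × ¬ OnCycle x × ∃[ k ] (MinimalArm x y k × isOdd k ≡ true)

  partner-exists : ∀ {x} → ¬ OnCycle x → ∃[ y ] Partner x y
  partner-exists {x} x∉cyc with two-neighbours x
  ... | a , b , xa , xb , a≢b with minimal-arm x∉cyc xa | minimal-arm x∉cyc xb
  ...   | ka , μa | kb , μb with isOdd ka in odd-ka
  ...     | true  = a , xa , x∉cyc , ka , μa , odd-ka
  ...     | false = b , xb , x∉cyc , kb , μb ,
                    trans (sym (trans (isOdd-+ ka kb) (cong (_xor isOdd kb) odd-ka))) (odd-arm-sum x∉cyc xa xb a≢b μa μb)

  partner-unique : ∀ {x y y′} → Partner x y → Partner x y′ → y ≡ y′
  partner-unique {y = y} {y′} (xy , x∉cyc , k , μ , odd-k) (xy′ , _ , k′ , μ′ , odd-k′) with y ≟ y′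
  ... | yes y≡y′ = y≡y′
  ... | no y≢y′ with trans (sym (odd-arm-sum x∉cyc xy xy′ y≢y′ μ μ′)) (trans (isOdd-+ k k′) (cong₂ _xor_ odd-k odd-k′))
  ...   | ()

  partner-offCycle : ∀ {x y} → Partner x y → ¬ OnCycle y
  partner-offCycle (xy , _ , k , μ , odd-k) y-cyc
    with MinimalArm⇒≤ μ (arm y-cyc wnil refl λ { (here refl) → Adj-irrefl xy refl })
  partner-offCycle (_ , _ , .0 , _ , ()) _ | z≤n

  partner-sym : ∀ {x y} → Partner x y → Partner y x
  partner-sym {x} {y} π@(xy , x∉cyc , ky , μy , odd-ky) with minimal-arm (partner-offCycle π) (Adj-sym xy)
  ... | k , μ@(arm z-cyc w len-w y∉w , _) with last-visit w (here refl) (λ { refl → x∉cyc z-cyc })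
  ... | lastVisit {y′} xy′ w′ x∉w′ w′<w w′⊆w with minimal-arm x∉cyc xy′
  ... | ky′ , μy′@(arm z′-cyc wy′ len-wy′ x∉wy′ , _) = Adj-sym xy , partner-offCycle π , k , μ , odd-k
    where
    y≢y′ : y ≢ y′
    y≢y′ refl = y∉w (w′⊆w (here refl))
    y∉wy′ : y ∉ verts wy′
    y∉wy′ y∈wy′ with prefix wy′ y∈wy′
    ... | w″ , w″⊆wy′ , _ = offCycle-separates x∉cyc xy′ xy (y≢y′ ∘ sym) (w″ , x∉wy′ ∘ w″⊆wy′)
    k≡1+ky′ : k ≡ suc ky′
    k≡1+ky′ = ≤-antisym
      (MinimalArm⇒≤ μ (arm z′-cyc (xy′ ∷w wy′) (cong suc len-wy′)
                          λ { (here refl) → Adj-irrefl xy refl ; (there y∈wy′) → y∉wy′ y∈wy′ }))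
      (begin
        suc ky′      ≤⟨ s≤s (MinimalArm⇒≤ μy′ (arm z-cyc w′ refl x∉w′)) ⟩
        suc (len w′) ≤⟨ w′<w ⟩
        len w        ≡⟨ len-w ⟩
        k            ∎)
      where open Data.Nat.Properties.≤-Reasoning
    odd-k : isOdd k ≡ true
    odd-k = begin
      isOdd k                ≡⟨ cong isOdd k≡1+ky′ ⟩
      not (isOdd ky′)        ≡⟨ true-xor (isOdd ky′) ⟨
      true xor isOdd ky′     ≡⟨ cong (_xor isOdd ky′) odd-ky ⟨
      isOdd ky xor isOdd ky′ ≡⟨ isOdd-+ ky ky′ ⟨
      isOdd (ky + ky′)       ≡⟨ odd-arm-sum x∉cyc xy xy′ y≢y′ μy μy′ ⟩
      true                   ∎
      where open ≡-Reasoning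

  Block : List V → Set
  Block p = IsCycle P p ⊎ ∃₂ λ x y → p ≡ x ∷ y ∷ [] × Partner x y

  Block⇒DiCycle : ∀ {p} → Block p → IsDiCycle P p
  Block⇒DiCycle (inj₁ (3≤ , u , l)) = ≤-trans (s≤s z≤n) 3≤ , u , Linked.map proj₂ l
  Block⇒DiCycle (inj₂ (x , y , refl , xy , _)) =
    s≤s z≤n , Unique-∷ (λ { (here refl) → Adj-irrefl xy refl }) (Unique-∷ (λ ()) []) ,
    proj₂ xy ∷ proj₂ (Adj-sym xy) ∷ [-]

  block-containing : ∀ {cs e} → All Block cs → e ∈ concat cs → ∃[ p ] (e ∈ p × p ∈ cs × Block p)
  block-containing {cs} blocks e∈ with ∈-concat⁻′ cs e∈
  ... | p , e∈p , p∈cs = p , e∈p , p∈cs , All.lookup blocks p∈cs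

  cycle-disjoint : ∀ {cs c x} → All Block cs → IsCycle P c → x ∈ c → x ∉ concat cs →
                   ∀ {e} → ¬ (e ∈ c × e ∈ concat cs)
  cycle-disjoint {cs} blocks c-cycle x∈c x∉ (e∈c , e∈) with block-containing blocks e∈
  ... | p , e∈p , p∈cs , inj₁ p-cycle =
    x∉ (∈-concat⁺′ (meeting-cycles-⊆ p-cycle c-cycle e∈p e∈c x∈c) p∈cs)
  ... | _ , here refl , _ , inj₂ (_ , _ , refl , _ , e∉cyc , _) = e∉cyc (_ , c-cycle , e∈c)
  ... | _ , there (here refl) , _ , inj₂ (_ , _ , refl , π)      = partner-offCycle π (_ , c-cycle , e∈c)

  partner-uncovered : ∀ {cs x y} → All Block cs → Partner x y → x ∉ concat cs → y ∉ concat cs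
  partner-uncovered {cs} blocks πxy x∉ y∈ with block-containing blocks y∈
  ... | p , y∈p , p∈cs , inj₁ p-cycle = partner-offCycle πxy (p , p-cycle , y∈p)
  ... | _ , here refl , p∈cs , inj₂ (_ , b , refl , πyb) =
    x∉ (∈-concat⁺′ (subst (_∈ _) (partner-unique πyb (partner-sym πxy)) (there (here refl))) p∈cs)
  ... | _ , there (here refl) , p∈cs , inj₂ (a , _ , refl , πay) =
    x∉ (∈-concat⁺′ (subst (_∈ _) (partner-unique (partner-sym πay) (partner-sym πxy)) (here refl)) p∈cs)

  -- Greedily add the cycle, or the partner pair, of an uncovered vertex; the fuel bounds the steps.
  extend-to-composite : ∀ fuel cs → All Block cs → Unique (concat cs) → n ≤ fuel + length (concat cs) →
             ∃[ ds ] (IsCompositeCycle P ds × compLength P ds ≡ n × cs ⊆ ds)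
  extend-to-composite fuel cs blocks u bound with any? (λ x → ¬? (x ∈? concat cs))
  ... | no none = cs , (All.map Block⇒DiCycle blocks , u) , ≤-antisym (Unique⇒length≤n u) full , id
    where
    full : n ≤ length (concat cs)
    full = subst (_≤ length (concat cs)) (length-tabulate id)
             (Unique-⊆⇒length≤ (allFin⁺ n) λ {x} _ → decidable-stable (x ∈? concat cs) (λ x∉ → none (x , x∉)))
  extend-to-composite zero cs blocks u bound | yes (x , x∉) = ⊥-elim (1+n≰n (≤-trans (Unique⇒length≤n (Unique-∷ x∉ u)) bound))
  extend-to-composite (suc fuel) cs blocks u bound | yes (x , x∉) with OnCycle? x
  ... | yes (c , c-cycle@(3≤ , c-unique , _) , x∈c) =
    let ds , composite , full , cs⊆ds = extend-to-composite fuel (c ∷ cs) (inj₁ c-cycle ∷ blocks)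
                                          (Unique-++⁺ c-unique u (cycle-disjoint blocks c-cycle x∈c x∉))
                                          (subst (λ m → n ≤ fuel + m) (sym (length-++ c))
                                            (≤-trans bound (1+m+n≤m+[k+n] fuel _ (≤-trans (s≤s z≤n) 3≤))))
    in ds , composite , full , cs⊆ds ∘ there
  ... | no x∉cyc with partner-exists x∉cyc
  ...   | y , πxy =
    let ds , composite , full , cs⊆ds = extend-to-composite fuel ((x ∷ y ∷ []) ∷ cs) (inj₂ (x , y , refl , πxy) ∷ blocks)
                                          (Unique-∷ (λ { (here refl) → Adj-irrefl (proj₁ πxy) refl ; (there x∈) → x∉ x∈ })
                                            (Unique-∷ (partner-uncovered blocks πxy x∉) u))
                                          (≤-trans bound (1+m+n≤m+[k+n] fuel _ (s≤s z≤n)))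
    in ds , composite , full , cs⊆ds ∘ there

mainTheorem18 : (n : ℕ) (P : SignPattern n) →
    Irreducible P → CombSymmetric P → ZeroDiagonal P →
    (∃[ c ] IsCycle P c) →
    ¬ HasLeaf P →
    (∀ c₁ c₂ → IsCycle P c₁ → IsCycle P c₂ → ¬ SameCycle P c₁ c₂ →
    PathAdjacent P c₁ c₂ → ∀ d → CycleDist P c₁ c₂ d → d % 2 ≡ 1) →
    (C : List (Fin n)) → IsCycle P C →
    ∃[ cs ] (IsCompositeCycle P cs × compLength P cs ≡ n × C ∈ cs)
mainTheorem18 n P irreducible csym _ some-cycle no-leaf odd-distance C C-cycle@(_ , C-unique , _)
  with extend-to-composite n (C ∷ []) (inj₁ C-cycle ∷ []) (Unique-++⁺ C-unique [] λ ()) (m≤m+n n _)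
  where open OddCycleDistances P irreducible csym some-cycle no-leaf odd-distance
... | cs , composite , full , C∷[]⊆cs = cs , composite , full , C∷[]⊆cs (here refl)
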